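{- Let $\mathbb{S}$ be a semifield of order $q^n$ with centre containing $\mathbb{F}_q$, represented on $\mathbb{F}_{q^n}$. Then $\mathrm{trk}(\mathbb{S}) \geq \mathrm{mrk}(\mathbb{S})$.
   Context: An $n$-dimensional algebra over $\mathbb{F}_q$ is $\mathbb{F}_{q^n}$ with $\mathbb{F}_q$-bilinear multiplication written uniquely as $\mathbb{S}(x,y)=\sum_{i,j=0}^{n-1}c_{ij}x^{q^i}y^{q^j}$, $c_{ij}\in\mathbb{F}_{q^n}$; $M(\mathbb{S})\in M_n(\mathbb{F}_{q^n})$ has $(i,j)$-entry $c_{ij}$ and $\mathrm{mrk}(\mathbb{S})=\mathrm{rank}(M(\mathbb{S}))$ over $\mathbb{F}_{q^n}$. Let $\mathrm{Tr}$ be the trace $\mathbb{F}_{q^n}\to\mathbb{F}_q$. Such algebras correspond to tensors in $V^\vee\otimes V^\vee\otimes V$ ($V=V(n,q)$), the fundamental tensors corresponding to the multiplications $(x,y)\mapsto\mathrm{Tr}(ax)\mathrm{Tr}(by)c$ with $a,b,c\in\mathbb{F}_{q^n}$. The tensor rank $\mathrm{trk}(\mathbb{S})$ is the least $N$ such that $\mathbb{S}(x,y)=\sum_{k=1}^N\mathrm{Tr}(a_kx)\mathrm{Tr}(b_ky)c_k$ for all $x,y$, for some $a_k,b_k,c_k\in\mathbb{F}_{q^n}$. -}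

module Defs where

open import Level using (Level)
open import Data.Nat using (ℕ; zero; suc; _≤_) renaming (_^_ to _^ℕ_)
open import Data.Fin using (Fin; zero; suc; toℕ)
open import Data.Product using (Σ; ∃; ∃₂; _×_; _,_)
open import Data.Sum using (_⊎_)
open import Relation.Nullary using (¬_)
open import Relation.Binary.PropositionalEquality using (_≡_)
open import Algebra.Bundles using (CommutativeRing)
open import Data.Nat.Primality using (Prime)

IsPrimePower : ℕ → Set
IsPrimePower q = ∃₂ λ p k → Prime p × 1 ≤ k × q ≡ p ^ℕ k

module _ {c ℓ : Level} (K : CommutativeRing c ℓ) where
  open CommutativeRing K using (Carrier; _≈_; _+_; _*_; 0#; 1#)

  IsField : Set (c Level.⊔ ℓ)
  IsField = (¬ (1# ≈ 0#)) × (∀ x → ¬ (x ≈ 0#) → ∃ λ y → (x * y) ≈ 1#)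

  HasCard : ℕ → Set (c Level.⊔ ℓ)
  HasCard N = Σ (Fin N → Carrier) λ e →
                (∀ i j → e i ≈ e j → i ≡ j) × (∀ x → ∃ λ i → e i ≈ x)

  pow : Carrier → ℕ → Carrier
  pow x zero    = 1#
  pow x (suc m) = x * pow x m

  sumF : ∀ {n} → (Fin n → Carrier) → Carrier
  sumF {zero}  f = 0#
  sumF {suc n} f = f zero + sumF (λ i → f (suc i))

  frob : ℕ → ℕ → Carrier → Carrier
  frob q i x = pow x (q ^ℕ i)

  Tr : ℕ → ℕ → Carrier → Carrier
  Tr q n x = sumF {n} (λ i → frob q (toℕ i) x)

  -- λ ∈ F_q  (the subfield fixed by x ↦ x^q)
  InFq : ℕ → Carrier → Set ℓ
  InFq q a = pow a q ≈ a

  IsFqBilinear : ℕ → (Carrier → Carrier → Carrier) → Set (c Level.⊔ ℓ)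
  IsFqBilinear q S =
      (∀ x x' y y' → x ≈ x' → y ≈ y' → S x y ≈ S x' y')
    × (∀ x x' y → S (x + x') y ≈ S x y + S x' y)
    × (∀ x y y' → S x (y + y') ≈ S x y + S x y')
    × (∀ a x y → InFq q a → S (a * x) y ≈ a * S x y)
    × (∀ a x y → InFq q a → S x (a * y) ≈ a * S x y)

  -- a semifield structure on K with centre containing F_q:
  -- F_q-bilinear multiplication, no zero divisors, two-sided identity
  IsSemifieldMult : ℕ → (Carrier → Carrier → Carrier) → Set (c Level.⊔ ℓ)
  IsSemifieldMult q S =
      IsFqBilinear q S
    × (∀ x y → S x y ≈ 0# → (x ≈ 0#) ⊎ (y ≈ 0#))
    × (∃ λ e → ∀ x → (S e x ≈ x) × (S x e ≈ x))

  RepresentedBy : ℕ → (n : ℕ) → (Carrier → Carrier → Carrier)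
                  → (Fin n → Fin n → Carrier) → Set (c Level.⊔ ℓ)
  RepresentedBy q n S cm = ∀ x y →
    S x y ≈ sumF (λ i → sumF (λ j → (cm i j * frob q (toℕ i) x) * frob q (toℕ j) y))

  TensorDecomp : ℕ → ℕ → (Carrier → Carrier → Carrier) → (N : ℕ)
                 → (Fin N → Carrier) → (Fin N → Carrier) → (Fin N → Carrier)
                 → Set (c Level.⊔ ℓ)
  TensorDecomp q n S N a b d = ∀ x y →
    S x y ≈ sumF (λ k → (Tr q n (a k * x) * Tr q n (b k * y)) * d k)

  RankAtLeast : (n : ℕ) → (Fin n → Fin n → Carrier) → ℕ → Set (c Level.⊔ ℓ)
  RankAtLeast n M r = Σ (Fin r → Fin n) λ col →
      (∀ k l → col k ≡ col l → k ≡ l)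
    × (∀ (λs : Fin r → Carrier)
         → (∀ i → sumF (λ k → λs k * M i (col k)) ≈ 0#)
         → ∀ k → λs k ≈ 0#)

module Submission where

-- Write x^[i] for x^(q^i).  Since Tr z = Σ_i z^[i] and (a x)^[i] = a^[i] x^[i],
-- a tensor decomposition S(x,y) = Σ_l Tr(a_l x) Tr(b_l y) d_l expands to
--   S(x,y) = Σ_{i,j} M'_ij x^[i] y^[j]   with   M'_ij = Σ_l (d_l b_l^[j]) a_l^[i].
-- The coefficients of such a bilinearised polynomial are determined by its values:
-- the exponents q^i (i < n) are distinct and smaller than |K| = q^n, and a
-- polynomial with fewer than |K| coefficients vanishing on all of K is zero.
-- Hence M = M', so every column of M lies in the span of the N vectors
-- (a_l^[i])_i, and the Steinitz exchange lemma bounds the number of linearly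
-- independent columns by N.

open import Defs
open import Level using (Level; _⊔_)
open import Data.Nat using (ℕ; zero; suc; _≤_; _<_; z≤n; s≤s; _^_)
open import Data.Nat.Properties using (*-mono-≤; m^n>0; <-cmp; <-irrefl; ^-monoʳ-<; m≤n⇒m≤1+n)
open import Data.Nat.Base using (nonTrivial⇒n>1; nonTrivial⇒nonZero)
open import Data.Nat.Primality using (prime)
open import Data.Fin using (Fin; zero; suc; toℕ; fromℕ<; punchIn)
import Data.Fin as Fin
open import Data.Fin.Properties using (suc-injective; toℕ-injective; toℕ-fromℕ<; toℕ<n; punchInᵢ≢i; all?; ¬∀⟶∃¬)
open import Data.Vec.Functional using (_∷_; tail; insertAt; removeAt)
open import Data.Vec.Functional.Properties using (insertAt-lookup; insertAt-punchIn)
open import Data.Product using (∃; _,_; proj₁; proj₂)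
open import Data.Empty using (⊥-elim)
open import Relation.Nullary using (¬_; Dec; yes; no)
open import Relation.Binary.Definitions using (Decidable; tri<; tri≈; tri>)
open import Relation.Binary.PropositionalEquality as P using (_≡_; _≢_)
open import Algebra.Bundles using (CommutativeRing)

module _ {c ℓ : Level} (K : CommutativeRing c ℓ) where
  open CommutativeRing K hiding (zero)
  open import Algebra.Properties.Ring ring using (-‿distribˡ-*; -1*x≈-x)
  open import Algebra.Properties.Group +-group using (x∙y⁻¹≈ε⇒x≈y)
  open import Algebra.Properties.Semiring.Sum semiring
    using (sum; sum-cong-≋; sum-cong-≗; sum-replicate-zero; sum-remove; ∑-distrib-+; ∑-comm;
           *-distribˡ-sum; *-distribʳ-sum)
  open import Algebra.Solver.Ring.NaturalCoefficients.Default commutativeSemiring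
    using (solve; _:+_; _:*_; _:=_)
  open import Relation.Binary.Reasoning.Setoid setoid

  sumF≡sum : ∀ {n} (f : Fin n → Carrier) → sumF K f ≡ sum f
  sumF≡sum {zero}  f = P.refl
  sumF≡sum {suc n} f = P.cong (f zero +_) (sumF≡sum (tail f))

  sum-zero : ∀ {n} {f : Fin n → Carrier} → (∀ i → f i ≈ 0#) → sum f ≈ 0#
  sum-zero {n} f≈0 = trans (sum-cong-≋ f≈0) (sum-replicate-zero n)

  sum-single : ∀ {n} (f : Fin n → Carrier) i → (∀ j → j ≢ i → f j ≈ 0#) → sum f ≈ f i
  sum-single {suc n} f i off = begin
    sum f                    ≈⟨ sum-remove {i = i} f ⟩
    f i + sum (removeAt f i) ≈⟨ +-congˡ (sum-zero (λ j → off (punchIn i j) (punchInᵢ≢i i j))) ⟩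
    f i + 0#                 ≈⟨ +-identityʳ (f i) ⟩
    f i                      ∎

  sum-sub : ∀ {n} (f g : Fin n → Carrier) → sum (λ i → f i - g i) ≈ sum f - sum g
  sum-sub f g = begin
    sum (λ i → f i - g i)             ≈⟨ ∑-distrib-+ f (λ i → - g i) ⟩
    sum f + sum (λ i → - g i)         ≈⟨ +-congˡ (sum-cong-≋ (λ i → -1*x≈-x (g i))) ⟨
    sum f + sum (λ i → - 1# * g i)    ≈⟨ +-congˡ (*-distribˡ-sum (- 1#) g) ⟨
    sum f + - 1# * sum g              ≈⟨ +-congˡ (-1*x≈-x (sum g)) ⟩
    sum f - sum g                     ∎

  sum-product : ∀ {m n} (f : Fin m → Carrier) (g : Fin n → Carrier) e →
                (sum f * sum g) * e ≈ sum (λ i → sum (λ j → (f i * g j) * e))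
  sum-product f g e = begin
    (sum f * sum g) * e                     ≈⟨ *-congʳ (*-distribʳ-sum (sum g) f) ⟩
    sum (λ i → f i * sum g) * e             ≈⟨ *-distribʳ-sum e (λ i → f i * sum g) ⟩
    sum (λ i → (f i * sum g) * e)           ≈⟨ sum-cong-≋ (λ i → *-congʳ (*-distribˡ-sum (f i) g)) ⟩
    sum (λ i → sum (λ j → f i * g j) * e)   ≈⟨ sum-cong-≋ (λ i → *-distribʳ-sum e (λ j → f i * g j)) ⟩
    sum (λ i → sum (λ j → (f i * g j) * e)) ∎

  pow-distrib : ∀ x y m → pow K (x * y) m ≈ pow K x m * pow K y m
  pow-distrib x y zero    = sym (*-identityˡ 1#)
  pow-distrib x y (suc m) = trans (*-congˡ (pow-distrib x y m)) (interchange x y _ _)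
    where
    interchange : ∀ a b c d → (a * b) * (c * d) ≈ (a * c) * (b * d)
    interchange = solve 4 (λ a b c d → (a :* b) :* (c :* d) := (a :* c) :* (b :* d)) refl

  -- Polynomials are coefficient vectors P : Fin L → K; horner P x evaluates
  -- Σ_m P_m x^m by Horner's rule, which makes division by x - α structural.
  horner : ∀ {L} → (Fin L → Carrier) → Carrier → Carrier
  horner {zero}  P x = 0#
  horner {suc L} P x = P zero + x * horner (tail P) x

  horner≈sum : ∀ {L} (P : Fin L → Carrier) x → horner P x ≈ sum (λ m → P m * pow K x (toℕ m))
  horner≈sum {zero}  P x = refl
  horner≈sum {suc L} P x = +-cong (sym (*-identityʳ (P zero))) (begin
    x * horner (tail P) x                                    ≈⟨ *-congˡ (horner≈sum (tail P) x) ⟩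
    x * sum (λ m → P (suc m) * pow K x (toℕ m))             ≈⟨ *-distribˡ-sum x (λ m → P (suc m) * pow K x (toℕ m)) ⟩
    sum (λ m → x * (P (suc m) * pow K x (toℕ m)))           ≈⟨ sum-cong-≋ (λ m → commute x (P (suc m)) _) ⟩
    sum (λ m → P (suc m) * (x * pow K x (toℕ m)))           ∎)
    where
    commute : ∀ x a b → x * (a * b) ≈ a * (x * b)
    commute = solve 3 (λ x a b → x :* (a :* b) := a :* (x :* b)) refl

  -- Synthetic division by x - α: the quotient of P, whose remainder is P(α).
  quotient : ∀ {L} → Carrier → (Fin (suc L) → Carrier) → Fin L → Carrier
  quotient {zero}  α P = λ ()
  quotient {suc L} α P = horner (tail P) α ∷ quotient α (tail P)

  division : ∀ {L} α (P : Fin (suc L) → Carrier) x →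
             horner P x ≈ (x - α) * horner (quotient α P) x + horner P α
  division {zero}  α P x = begin
    P zero + x * 0#              ≈⟨ +-congˡ (trans (zeroʳ x) (sym (zeroʳ α))) ⟩
    P zero + α * 0#              ≈⟨ +-identityˡ _ ⟨
    0# + (P zero + α * 0#)       ≈⟨ +-congʳ (zeroʳ (x - α)) ⟨
    (x - α) * 0# + (P zero + α * 0#) ∎
  division {suc L} α P x = begin
    p + x * horner P′ x                      ≈⟨ +-congˡ (*-congˡ (division α P′ x)) ⟩
    p + x * ((x - α) * H + r)                ≈⟨ +-congˡ (*-congʳ x≈y+α) ⟩
    p + (y + α) * (y * H + r)                ≈⟨ expand p y α H r ⟩
    y * (r + x′ * H) + (p + α * r)           ≈⟨ +-congʳ (*-congˡ (+-congˡ (*-congʳ x≈y+α))) ⟨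
    y * (r + x * H) + (p + α * r)            ∎
    where
    P′ : Fin (suc L) → Carrier
    P′ = tail P
    p r y x′ H : Carrier
    p = P zero
    r = horner P′ α
    y = x - α
    x′ = y + α
    H = horner (quotient α P′) x
    x≈y+α : x ≈ y + α
    x≈y+α = sym (trans (+-assoc x (- α) α) (trans (+-congˡ (-‿inverseˡ α)) (+-identityʳ x)))
    expand : ∀ p y α H r → p + (y + α) * (y * H + r) ≈ y * (r + (y + α) * H) + (p + α * r)
    expand = solve 5 (λ p y α H r → p :+ (y :+ α) :* (y :* H :+ r)
                                   := y :* (r :+ (y :+ α) :* H) :+ (p :+ α :* r)) refl

  field-cancel : IsField K → ∀ {a y} → ¬ a ≈ 0# → a * y ≈ 0# → y ≈ 0#
  field-cancel (_ , inverse) {a} {y} a≉0 ay≈0 with inverse a a≉0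
  ... | a⁻¹ , aa⁻¹≈1 = begin
    y              ≈⟨ *-identityˡ y ⟨
    1# * y         ≈⟨ *-congʳ (trans (sym aa⁻¹≈1) (*-comm a a⁻¹)) ⟩
    (a⁻¹ * a) * y  ≈⟨ *-assoc a⁻¹ a y ⟩
    a⁻¹ * (a * y)  ≈⟨ *-congˡ ay≈0 ⟩
    a⁻¹ * 0#       ≈⟨ zeroʳ a⁻¹ ⟩
    0#             ∎

  quotient-zero : ∀ {L} α (P : Fin (suc L) → Carrier) →
                  (∀ m → quotient α P m ≈ 0#) → horner P α ≈ 0# → ∀ m → P m ≈ 0#
  quotient-zero {zero}  α P _    Pα≈0 zero = begin
    P zero           ≈⟨ +-identityʳ (P zero) ⟨
    P zero + 0#      ≈⟨ +-congˡ (zeroʳ α) ⟨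
    P zero + α * 0#  ≈⟨ Pα≈0 ⟩
    0#               ∎
  quotient-zero {suc L} α P Q≈0 Pα≈0 zero = begin
    P zero                           ≈⟨ +-identityʳ (P zero) ⟨
    P zero + 0#                      ≈⟨ +-congˡ (trans (*-congˡ (Q≈0 zero)) (zeroʳ α)) ⟨
    P zero + α * horner (tail P) α   ≈⟨ Pα≈0 ⟩
    0#                               ∎
  quotient-zero {suc L} α P Q≈0 _    (suc m) =
    quotient-zero α (tail P) (λ m → Q≈0 (suc m)) (Q≈0 zero) m

  root-bound : IsField K → ∀ {L} (P : Fin L → Carrier) (pts : Fin L → Carrier) →
               (∀ s t → pts s ≈ pts t → s ≡ t) → (∀ t → horner P (pts t) ≈ 0#) →
               ∀ m → P m ≈ 0#
  root-bound fld {zero}  P pts distinct roots ()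
  root-bound fld {suc L} P pts distinct roots =
    quotient-zero α P (root-bound fld (quotient α P) (tail pts) distinct′ quotient-roots) (roots zero)
    where
    α : Carrier
    α = pts zero
    distinct′ : ∀ s t → pts (suc s) ≈ pts (suc t) → s ≡ t
    distinct′ s t eq = suc-injective (distinct (suc s) (suc t) eq)
    quotient-roots : ∀ t → horner (quotient α P) (pts (suc t)) ≈ 0#
    quotient-roots t = field-cancel fld z-α≉0 (begin
      (z - α) * horner (quotient α P) z            ≈⟨ +-identityʳ _ ⟨
      (z - α) * horner (quotient α P) z + 0#       ≈⟨ +-congˡ (roots zero) ⟨
      (z - α) * horner (quotient α P) z + horner P α ≈⟨ division α P z ⟨
      horner P z                                   ≈⟨ roots (suc t) ⟩
      0#                                           ∎)
      where
      z : Carrier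
      z = pts (suc t)
      z-α≉0 : ¬ z - α ≈ 0#
      z-α≉0 eq with distinct (suc t) zero (x∙y⁻¹≈ε⇒x≈y z α eq)
      ... | ()

  when : ∀ {p} {A : Set p} → Dec A → Carrier → Carrier
  when (yes _) a = a
  when (no _)  a = 0#

  when-yes : ∀ {p} {A : Set p} (D : Dec A) a → A → when D a ≈ a
  when-yes (yes _) a _ = refl
  when-yes (no ¬A) a x = ⊥-elim (¬A x)

  when-no : ∀ {p} {A : Set p} (D : Dec A) a → ¬ A → when D a ≈ 0#
  when-no (yes x) a ¬A = ⊥-elim (¬A x)
  when-no (no _)  a _  = refl

  scatter : ∀ {n L} → (Fin n → Fin L) → (Fin n → Carrier) → Fin L → Carrier
  scatter e d m = sum (λ i → when (e i Fin.≟ m) (d i))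

  scatter-at : ∀ {n L} (e : Fin n → Fin L) → (∀ i j → e i ≡ e j → i ≡ j) →
               ∀ d i → scatter e d (e i) ≈ d i
  scatter-at e e-injective d i = begin
    sum (λ j → when (e j Fin.≟ e i) (d j)) ≈⟨ sum-single _ i other ⟩
    when (e i Fin.≟ e i) (d i)             ≈⟨ when-yes (e i Fin.≟ e i) (d i) P.refl ⟩
    d i                                    ∎
    where
    other : ∀ j → j ≢ i → when (e j Fin.≟ e i) (d j) ≈ 0#
    other j j≢i = when-no (e j Fin.≟ e i) (d j) (λ eq → j≢i (e-injective j i eq))

  horner-scatter : ∀ {n L} (e : Fin n → Fin L) d x →
                   horner (scatter e d) x ≈ sum (λ i → d i * pow K x (toℕ (e i)))
  horner-scatter {n} {L} e d x = begin
    horner (scatter e d) x                                     ≈⟨ horner≈sum (scatter e d) x ⟩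
    sum (λ m → scatter e d m * X m)                            ≈⟨ sum-cong-≋ (λ m → *-distribʳ-sum (X m) (λ i → term i m)) ⟩
    sum (λ (m : Fin L) → sum (λ (i : Fin n) → term i m * X m)) ≈⟨ ∑-comm (λ m i → term i m * X m) ⟩
    sum (λ (i : Fin n) → sum (λ (m : Fin L) → term i m * X m)) ≈⟨ sum-cong-≋ (λ i → sum-single _ (e i) (other i)) ⟩
    sum (λ i → term i (e i) * X (e i))                         ≈⟨ sum-cong-≋ (λ i → *-congʳ (when-yes (e i Fin.≟ e i) (d i) P.refl)) ⟩
    sum (λ i → d i * X (e i))                                  ∎
    where
    X : Fin L → Carrier
    X m = pow K x (toℕ m)
    term : Fin n → Fin L → Carrier
    term i m = when (e i Fin.≟ m) (d i)
    other : ∀ i m → m ≢ e i → term i m * X m ≈ 0#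
    other i m m≢ei = trans (*-congʳ (when-no (e i Fin.≟ m) (d i) (λ eq → m≢ei (P.sym eq)))) (zeroˡ (X m))

  sparse-root-bound : IsField K → ∀ {n L} (e : Fin n → Fin L) → (∀ i j → e i ≡ e j → i ≡ j) →
                      (pts : Fin L → Carrier) → (∀ s t → pts s ≈ pts t → s ≡ t) →
                      (d : Fin n → Carrier) → (∀ t → sum (λ i → d i * pow K (pts t) (toℕ (e i))) ≈ 0#) →
                      ∀ i → d i ≈ 0#
  sparse-root-bound fld e e-injective pts distinct d vanish i = begin
    d i                ≈⟨ scatter-at e e-injective d i ⟨
    scatter e d (e i)  ≈⟨ root-bound fld (scatter e d) pts distinct roots (e i) ⟩
    0#                 ∎
    where
    roots : ∀ t → horner (scatter e d) (pts t) ≈ 0#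
    roots t = trans (horner-scatter e d (pts t)) (vanish t)

  ^-injective : ∀ q → 1 < q → ∀ {a b} → q ^ a ≡ q ^ b → a ≡ b
  ^-injective q q>1 {a} {b} eq with <-cmp a b
  ... | tri< a<b _ _ = ⊥-elim (<-irrefl eq (^-monoʳ-< q q>1 a<b))
  ... | tri≈ _ a≡b _ = a≡b
  ... | tri> _ _ b<a = ⊥-elim (<-irrefl (P.sym eq) (^-monoʳ-< q q>1 b<a))

  frobExponent : ∀ q n → 1 < q → Fin n → Fin (q ^ n)
  frobExponent q n q>1 i = fromℕ< (^-monoʳ-< q q>1 (toℕ<n i))

  frobExponent-injective : ∀ q n (q>1 : 1 < q) i j →
                           frobExponent q n q>1 i ≡ frobExponent q n q>1 j → i ≡ j
  frobExponent-injective q n q>1 i j eq = toℕ-injective (^-injective q q>1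
    (P.trans (P.sym (toℕ-fromℕ< _)) (P.trans (P.cong toℕ eq) (toℕ-fromℕ< _))))

  linearised-zero : IsField K → ∀ q n → 1 < q → HasCard K (q ^ n) →
                    (d : Fin n → Carrier) → (∀ x → sum (λ i → d i * frob K q (toℕ i) x) ≈ 0#) →
                    ∀ i → d i ≈ 0#
  linearised-zero fld q n q>1 (pts , distinct , _) d vanish =
    sparse-root-bound fld (frobExponent q n q>1) (frobExponent-injective q n q>1) pts distinct d
      (λ t → trans (sum-cong-≋ (λ i → *-congˡ (exponent t i))) (vanish (pts t)))
    where
    exponent : ∀ t i → pow K (pts t) (toℕ (frobExponent q n q>1 i)) ≈ frob K q (toℕ i) (pts t)
    exponent t i = reflexive (P.cong (pow K (pts t)) (toℕ-fromℕ< (^-monoʳ-< q q>1 (toℕ<n i))))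

  bilinear : ℕ → ∀ n → (Fin n → Fin n → Carrier) → Carrier → Carrier → Carrier
  bilinear q n A x y = sum (λ i → sum (λ j → (A i j * frob K q (toℕ i) x) * frob K q (toℕ j) y))

  -- On a field with q^n elements, a bilinearised polynomial vanishing everywhere
  -- has zero coefficients: apply linearised-zero in x, then in y.
  bilinear-zero : IsField K → ∀ q n → 1 < q → HasCard K (q ^ n) →
                  (A : Fin n → Fin n → Carrier) → (∀ x y → bilinear q n A x y ≈ 0#) →
                  ∀ i j → A i j ≈ 0#
  bilinear-zero fld q n q>1 card A vanish i =
    linearised-zero fld q n q>1 card (A i) (λ y → row-vanishes y i)
    where
    X : Fin n → Carrier → Carrier
    X i = frob K q (toℕ i)
    swap : ∀ a x y → (a * y) * x ≈ (a * x) * y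
    swap = solve 3 (λ a x y → (a :* y) :* x := (a :* x) :* y) refl
    row-vanishes : ∀ y i → sum (λ j → A i j * X j y) ≈ 0#
    row-vanishes y = linearised-zero fld q n q>1 card (λ i → sum (λ j → A i j * X j y)) (λ x → begin
      sum (λ i → sum (λ j → A i j * X j y) * X i x)       ≈⟨ sum-cong-≋ (λ i → *-distribʳ-sum (X i x) (λ j → A i j * X j y)) ⟩
      sum (λ i → sum (λ j → (A i j * X j y) * X i x))     ≈⟨ sum-cong-≋ (λ i → sum-cong-≋ (λ j → swap (A i j) (X i x) (X j y))) ⟩
      bilinear q n A x y                                  ≈⟨ vanish x y ⟩
      0#                                                  ∎)

  bilinear-sub : ∀ q n (A B : Fin n → Fin n → Carrier) x y →
                 bilinear q n (λ i j → A i j - B i j) x y ≈ bilinear q n A x y - bilinear q n B x y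
  bilinear-sub q n A B x y = begin
    sum (λ i → sum (λ j → ((A i j - B i j) * X i x) * X j y)) ≈⟨ sum-cong-≋ (λ i → sum-cong-≋ (λ j → term i j)) ⟩
    sum (λ i → sum (λ j → a i j - b i j))                     ≈⟨ sum-cong-≋ (λ i → sum-sub (a i) (b i)) ⟩
    sum (λ i → sum (a i) - sum (b i))                         ≈⟨ sum-sub (λ i → sum (a i)) (λ i → sum (b i)) ⟩
    bilinear q n A x y - bilinear q n B x y                   ∎
    where
    X : Fin n → Carrier → Carrier
    X i = frob K q (toℕ i)
    a b : Fin n → Fin n → Carrier
    a i j = (A i j * X i x) * X j y
    b i j = (B i j * X i x) * X j y
    sub-distribʳ : ∀ a b z → (a - b) * z ≈ a * z - b * z
    sub-distribʳ a b z = trans (distribʳ z a (- b)) (+-congˡ (sym (-‿distribˡ-* b z)))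
    term : ∀ i j → ((A i j - B i j) * X i x) * X j y ≈ a i j - b i j
    term i j = trans (*-congʳ (sub-distribʳ (A i j) (B i j) (X i x))) (sub-distribʳ _ _ (X j y))

  bilinear-unique : IsField K → ∀ q n → 1 < q → HasCard K (q ^ n) →
                    (A B : Fin n → Fin n → Carrier) → (∀ x y → bilinear q n A x y ≈ bilinear q n B x y) →
                    ∀ i j → A i j ≈ B i j
  bilinear-unique fld q n q>1 card A B agree i j =
    x∙y⁻¹≈ε⇒x≈y (A i j) (B i j) (bilinear-zero fld q n q>1 card (λ i j → A i j - B i j) difference i j)
    where
    difference : ∀ x y → bilinear q n (λ i j → A i j - B i j) x y ≈ 0#
    difference x y = trans (bilinear-sub q n A B x y)
      (trans (+-congʳ (agree x y)) (-‿inverseʳ (bilinear q n B x y)))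

  Independent : ∀ {r n} → (Fin r → Fin n → Carrier) → Set (c ⊔ ℓ)
  Independent {r} v = ∀ (λs : Fin r → Carrier) →
                      (∀ i → sum (λ k → λs k * v k i) ≈ 0#) → ∀ k → λs k ≈ 0#

  Combinations : ∀ {r N n} → (Fin r → Fin n → Carrier) → (Fin r → Fin N → Carrier) →
                 (Fin N → Fin n → Carrier) → Set ℓ
  Combinations v w u = ∀ k i → v k i ≈ sum (λ l → w k l * u l i)

  -- Adding multiples of v_k₀ to the other vectors and then dropping v_k₀
  -- preserves linear independence: a relation among the new vectors is a
  -- relation among the old ones with coefficient Σ_j μ_j t_j at k₀.
  elimination-independent : ∀ {r n} (v : Fin (suc r) → Fin n → Carrier) → Independent v →
                            ∀ k₀ (t : Fin r → Carrier) →
                            Independent (λ j i → v (punchIn k₀ j) i + t j * v k₀ i)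
  elimination-independent {r} v ind k₀ t μ relation j = begin
    μ j                ≡⟨ insertAt-punchIn μ k₀ s j ⟨
    λs (punchIn k₀ j)  ≈⟨ ind λs old-relation (punchIn k₀ j) ⟩
    0#                 ∎
    where
    s : Carrier
    s = sum (λ j → μ j * t j)
    λs : Fin (suc r) → Carrier
    λs = insertAt μ k₀ s
    regroup : ∀ m t a b → (m * t) * b + m * a ≈ m * (a + t * b)
    regroup = solve 4 (λ m t a b → (m :* t) :* b :+ m :* a := m :* (a :+ t :* b)) refl
    old-relation : ∀ i → sum (λ k → λs k * v k i) ≈ 0#
    old-relation i = begin
      sum (λ k → λs k * v k i)
        ≈⟨ sum-remove {i = k₀} (λ k → λs k * v k i) ⟩
      λs k₀ * v k₀ i + sum (λ j → λs (punchIn k₀ j) * v (punchIn k₀ j) i)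
        ≈⟨ +-cong (*-congʳ (reflexive (insertAt-lookup μ k₀ s)))
                  (sum-cong-≋ (λ j → *-congʳ (reflexive (insertAt-punchIn μ k₀ s j)))) ⟩
      s * v k₀ i + sum (λ j → μ j * v (punchIn k₀ j) i)
        ≈⟨ +-congʳ (*-distribʳ-sum (v k₀ i) (λ j → μ j * t j)) ⟩
      sum (λ j → (μ j * t j) * v k₀ i) + sum (λ j → μ j * v (punchIn k₀ j) i)
        ≈⟨ ∑-distrib-+ (λ j → (μ j * t j) * v k₀ i) (λ j → μ j * v (punchIn k₀ j) i) ⟨
      sum (λ j → (μ j * t j) * v k₀ i + μ j * v (punchIn k₀ j) i)
        ≈⟨ sum-cong-≋ (λ j → regroup (μ j) (t j) (v (punchIn k₀ j) i) (v k₀ i)) ⟩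
      sum (λ j → μ j * (v (punchIn k₀ j) i + t j * v k₀ i))
        ≈⟨ relation i ⟩
      0# ∎

  drop-first : ∀ {N} (α u : Fin (suc N) → Carrier) → α zero ≈ 0# →
               sum (λ l → α l * u l) ≈ sum (λ l → α (suc l) * u (suc l))
  drop-first α u α₀≈0 = trans (+-congʳ (trans (*-congʳ α₀≈0) (zeroˡ (u zero)))) (+-identityˡ _)

  eliminate-first : ∀ {N} (α β u : Fin (suc N) → Carrier) t → α zero + t * β zero ≈ 0# →
                    sum (λ l → α l * u l) + t * sum (λ l → β l * u l) ≈
                    sum (λ l → (α (suc l) + t * β (suc l)) * u (suc l))
  eliminate-first α β u t cancels = begin
    sum (λ l → α l * u l) + t * sum (λ l → β l * u l)
      ≈⟨ +-congˡ (*-distribˡ-sum t (λ l → β l * u l)) ⟩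
    sum (λ l → α l * u l) + sum (λ l → t * (β l * u l))
      ≈⟨ ∑-distrib-+ (λ l → α l * u l) (λ l → t * (β l * u l)) ⟨
    sum (λ l → α l * u l + t * (β l * u l))
      ≈⟨ sum-cong-≋ (λ l → collect (α l) (β l) (u l) t) ⟩
    sum (λ l → (α l + t * β l) * u l)
      ≈⟨ drop-first (λ l → α l + t * β l) u cancels ⟩
    sum (λ l → (α (suc l) + t * β (suc l)) * u (suc l)) ∎
    where
    collect : ∀ a b u t → a * u + t * (b * u) ≈ (a + t * b) * u
    collect = solve 4 (λ a b u t → a :* u :+ t :* (b :* u) := (a :+ t :* b) :* u) refl

  -- Induction on N:
  -- either no v_k uses u₀, or we pivot on some v_k₀ that does and eliminate u₀
  -- from the remaining r - 1 vectors.
  steinitz : IsField K → Decidable _≈_ → ∀ {n} N r (v : Fin r → Fin n → Carrier)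
             (w : Fin r → Fin N → Carrier) (u : Fin N → Fin n → Carrier) →
             Combinations v w u → Independent v → r ≤ N
  steinitz _   _   zero    zero    _ _ _ _    _   = z≤n
  steinitz fld _   zero    (suc r) v _ _ span ind = ⊥-elim (proj₁ fld (ind (λ _ → 1#) ones zero))
    where
    ones : ∀ i → sum (λ k → 1# * v k i) ≈ 0#
    ones i = sum-zero (λ k → trans (*-congˡ (span k i)) (zeroʳ 1#))
  steinitz _   _   (suc N) zero    _ _ _ _    _   = z≤n
  steinitz fld _≟_ {n} (suc N) (suc r) v w u span ind with all? (λ k → w k zero ≟ 0#)
  ... | yes unused = m≤n⇒m≤1+n (steinitz fld _≟_ N (suc r) v (λ k l → w k (suc l)) (λ l → u (suc l))
                                  (λ k i → trans (span k i) (drop-first (w k) (λ l → u l i) (unused k))) ind)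
  ... | no used = s≤s (pivot (¬∀⟶∃¬ _ (λ k → w k zero ≈ 0#) (λ k → w k zero ≟ 0#) used))
    where
    pivot : (∃ λ k₀ → ¬ w k₀ zero ≈ 0#) → r ≤ N
    pivot (k₀ , β≉0) with proj₂ fld (w k₀ zero) β≉0
    ... | γ , βγ≈1 = steinitz fld _≟_ N r v′ w′ (λ l → u (suc l)) span′ (elimination-independent v ind k₀ t)
      where
      β : Carrier
      β = w k₀ zero
      t : Fin r → Carrier
      t j = - (w (punchIn k₀ j) zero * γ)
      v′ : Fin r → Fin n → Carrier
      v′ j i = v (punchIn k₀ j) i + t j * v k₀ i
      w′ : Fin r → Fin N → Carrier
      w′ j l = w (punchIn k₀ j) (suc l) + t j * w k₀ (suc l)
      cancels : ∀ a → a + - (a * γ) * β ≈ 0#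
      cancels a = begin
        a + - (a * γ) * β  ≈⟨ +-congˡ (-‿distribˡ-* (a * γ) β) ⟨
        a + - (a * γ * β)  ≈⟨ +-congˡ (-‿cong (trans (*-assoc a γ β) (*-congˡ (trans (*-comm γ β) βγ≈1)))) ⟩
        a + - (a * 1#)     ≈⟨ +-congˡ (-‿cong (*-identityʳ a)) ⟩
        a - a              ≈⟨ -‿inverseʳ a ⟩
        0#                 ∎
      span′ : Combinations v′ w′ (λ l → u (suc l))
      span′ j i = trans (+-cong (span (punchIn k₀ j) i) (*-congˡ (span k₀ i)))
                        (eliminate-first (w (punchIn k₀ j)) (w k₀) (λ l → u l i) (t j)
                                         (cancels (w (punchIn k₀ j) zero)))

  finite-decidable : ∀ {N} → HasCard K N → Decidable _≈_
  finite-decidable (e , e-injective , onto) x y with onto x | onto y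
  ... | i , eᵢ≈x | j , eⱼ≈y with i Fin.≟ j
  ...   | yes P.refl = yes (trans (sym eᵢ≈x) eⱼ≈y)
  ...   | no i≢j     = no (λ x≈y → i≢j (e-injective i j (trans eᵢ≈x (trans x≈y (sym eⱼ≈y)))))

  trace-product : ∀ q n z x →
                  Tr K q n (z * x) ≈ sum (λ (i : Fin n) → frob K q (toℕ i) z * frob K q (toℕ i) x)
  trace-product q n z x = trans (reflexive (sumF≡sum {n} _)) (sum-cong-≋ {n} (λ i → pow-distrib z x (q ^ toℕ i)))

  decompositionMatrix : ∀ q n {N} (a b d : Fin N → Carrier) → Fin n → Fin n → Carrier
  decompositionMatrix q n a b d i j = sum (λ l → (d l * frob K q (toℕ j) (b l)) * frob K q (toℕ i) (a l))

  decomposition-expansion : ∀ q n {N} (a b d : Fin N → Carrier) x y →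
                            sum (λ l → (Tr K q n (a l * x) * Tr K q n (b l * y)) * d l) ≈
                            bilinear q n (decompositionMatrix q n a b d) x y
  decomposition-expansion q n {N} a b d x y = begin
    sum (λ l → (Tr K q n (a l * x) * Tr K q n (b l * y)) * d l)
      ≈⟨ sum-cong-≋ (λ l → *-congʳ (*-cong (trace-product q n (a l) x) (trace-product q n (b l) y))) ⟩
    sum (λ l → (sum (λ i → X i (a l) * X i x) * sum (λ j → X j (b l) * X j y)) * d l)
      ≈⟨ sum-cong-≋ (λ l → sum-product (λ i → X i (a l) * X i x) (λ j → X j (b l) * X j y) (d l)) ⟩
    sum (λ l → sum (λ i → sum (λ j → T l i j)))
      ≈⟨ ∑-comm (λ l i → sum (λ j → T l i j)) ⟩
    sum (λ i → sum (λ l → sum (λ j → T l i j)))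
      ≈⟨ sum-cong-≋ (λ i → ∑-comm (λ l j → T l i j)) ⟩
    sum (λ i → sum (λ j → sum (λ l → T l i j)))
      ≈⟨ sum-cong-≋ (λ i → sum-cong-≋ (λ j → sum-cong-≋ (λ l → rearrange (d l) (X j (b l)) (X i (a l)) (X i x) (X j y)))) ⟨
    sum (λ i → sum (λ j → sum (λ l → ((m l i j * X i x) * X j y))))
      ≈⟨ sum-cong-≋ (λ i → sum-cong-≋ (λ j → *-distribʳ-sum (X j y) (λ l → m l i j * X i x))) ⟨
    sum (λ i → sum (λ j → sum (λ l → m l i j * X i x) * X j y))
      ≈⟨ sum-cong-≋ (λ i → sum-cong-≋ (λ j → *-congʳ (*-distribʳ-sum (X i x) (λ l → m l i j)))) ⟨
    bilinear q n (decompositionMatrix q n a b d) x y ∎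
    where
    X : Fin n → Carrier → Carrier
    X i = frob K q (toℕ i)
    T : Fin N → Fin n → Fin n → Carrier
    T l i j = ((X i (a l) * X i x) * (X j (b l) * X j y)) * d l
    m : Fin N → Fin n → Fin n → Carrier
    m l i j = (d l * X j (b l)) * X i (a l)
    rearrange : ∀ d b a x y → (((d * b) * a) * x) * y ≈ ((a * x) * (b * y)) * d
    rearrange = solve 5 (λ d b a x y → (((d :* b) :* a) :* x) :* y := ((a :* x) :* (b :* y)) :* d) refl

  matrix-of-decomposition : IsField K → ∀ q n → 1 < q → HasCard K (q ^ n) → ∀ S M →
                            RepresentedBy K q n S M → ∀ N a b d → TensorDecomp K q n S N a b d →
                            ∀ i j → M i j ≈ decompositionMatrix q n a b d i j
  matrix-of-decomposition fld q n q>1 card S M represented N a b d decomposed =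
    bilinear-unique fld q n q>1 card M (decompositionMatrix q n a b d) (λ x y → begin
      bilinear q n M x y
        ≈⟨ reflexive (P.trans (sumF≡sum {n} _) (sum-cong-≗ {n} (λ i → sumF≡sum {n} _))) ⟨
      sumF K (λ i → sumF K (λ j → (M i j * frob K q (toℕ i) x) * frob K q (toℕ j) y))
        ≈⟨ represented x y ⟨
      S x y
        ≈⟨ decomposed x y ⟩
      sumF K (λ l → (Tr K q n (a l * x) * Tr K q n (b l * y)) * d l)
        ≈⟨ reflexive (sumF≡sum {N} _) ⟩
      sum (λ l → (Tr K q n (a l * x) * Tr K q n (b l * y)) * d l)
        ≈⟨ decomposition-expansion q n a b d x y ⟩
      bilinear q n (decompositionMatrix q n a b d) x y ∎)

prime-power>1 : ∀ {q} → IsPrimePower q → 1 < q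
prime-power>1 (p , suc k , prime {{nontrivial}} _ , _ , P.refl) =
  *-mono-≤ (nonTrivial⇒n>1 p {{nontrivial}}) (m^n>0 p {{nonTrivial⇒nonZero p {{nontrivial}}}} k)

mainTheorem11 : ∀ {c ℓ : Level} (K : CommutativeRing c ℓ) → IsField K
    → (q n : ℕ) → IsPrimePower q → HasCard K (q ^ n)
    → (S : CommutativeRing.Carrier K → CommutativeRing.Carrier K → CommutativeRing.Carrier K)
    → IsSemifieldMult K q S
    → (M : Fin n → Fin n → CommutativeRing.Carrier K) → RepresentedBy K q n S M
    → (N : ℕ) (a b d : Fin N → CommutativeRing.Carrier K) → TensorDecomp K q n S N a b d
    → (r : ℕ) → RankAtLeast K n M r
    → r ≤ N
mainTheorem11 K fld q n q-prime-power card S _ M represented N a b d decomposed r (col , _ , independent) =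
  steinitz K fld (finite-decidable K card) N r column coefficient generator column-combinations column-independent
  where
  open CommutativeRing K using (Carrier; _*_; trans; reflexive)
  column : Fin r → Fin n → Carrier
  column k i = M i (col k)
  generator : Fin N → Fin n → Carrier
  generator l i = frob K q (toℕ i) (a l)
  coefficient : Fin r → Fin N → Carrier
  coefficient k l = d l * frob K q (toℕ (col k)) (b l)
  column-combinations : Combinations K column coefficient generator
  column-combinations k i = matrix-of-decomposition K fld q n (prime-power>1 q-prime-power) card S M
                              represented N a b d decomposed i (col k)
  column-independent : Independent K column
  column-independent λs relation = independent λs (λ i → trans (reflexive (sumF≡sum K {r} _)) (relation i))
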